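{- Fix an integer $m\ge1$. For every $n\ge2$ and every $p,q\in B_m$, \[ T_{p,q}^{(m)}(n)=\sum_{k=1}^{\min(m,n-1)} c_{k,p}\,T_{m-k,\,q-k}^{(m)}(n-k)+T_{p-1,\,m-1}^{(m)}(n-1), \] where $\infty-r=\infty$ for every integer $r\ge0$ and any term with a negative (finite) threshold is interpreted as zero. In particular, for $n\ge m+1$, \[ T_{p,q}^{(m)}(n)=\sum_{k=1}^{m} c_{k,p}\,T_{m-k,\,q-k}^{(m)}(n-k)+T_{p-1,\,m-1}^{(m)}(n-1). \]
   Context: A permutation $\pi=\pi_1\cdots\pi_n\in S_n$ contains the pattern $132$ if there are indices $i<j<k$ with $\pi_i<\pi_k<\pi_j$, and avoids $132$ otherwise; $\operatorname{Av}_n(132)$ denotes the set of $132$-avoiding permutations in $S_n$. For a fixed integer $m\ge1$, let $\mathcal A_n^{(m)}$ be the set of $\pi\in\operatorname{Av}_n(132)$ with $|\pi_{i+1}-\pi_i|\le m$ for all $1\le i<n$. Let $B_m=\{0,1,\ldots,m-1,\infty\}$. For $u,v\in\mathbb Z\cup\{\infty\}$ and $n\ge1$, let $T_{u,v}^{(m)}(n)$ be the number of $\pi\in\mathcal A_n^{(m)}$ with $n-\pi_1\le u$ and $n-\pi_n\le v$, where an inequality with threshold $\infty$ is vacuous (so $T_{u,v}^{(m)}(n)=0$ if $u<0$ or $v<0$). For $1\le k\le m$ and $p\in B_m$, set $c_{1,p}=1$ and, for $k\ge2$, $c_{k,p}=|\{\sigma\in\operatorname{Av}_{k-1}(132): k-\sigma_1\le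 p\}|$ (vacuous condition if $p=\infty$). -}

module Defs where

open import Data.Bool using (Bool; true; false; _∧_; _∨_; not; if_then_else_)
open import Data.Nat as ℕ using (ℕ; zero; suc; _∸_; _<ᵇ_; _≡ᵇ_; ∣_-_∣; _⊔_; _⊓_)
open import Data.Integer as ℤ using (ℤ; +_; _-_)
open import Data.List using (List; []; _∷_; length; map; concatMap; filterᵇ; upTo)
open import Data.Bool.ListAction using (any)

-- Permutations of [n] are represented as lists π₁ ⋯ πₙ of naturals.
-- All words of length l over the alphabet {1,…,a}:
words : ℕ → ℕ → List (List ℕ)
words a zero    = [] ∷ []
words a (suc l) = concatMap (λ x → map (x ∷_) (words a l)) (map suc (upTo a))

nodup : List ℕ → Bool
nodup []       = true
nodup (x ∷ xs) = not (any (λ y → x ≡ᵇ y) xs) ∧ nodup xs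

perms : ℕ → List (List ℕ)
perms n = filterᵇ nodup (words n n)

hasPair : ℕ → List ℕ → Bool
hasPair a []       = false
hasPair a (b ∷ ys) = any (λ c → (a <ᵇ c) ∧ (c <ᵇ b)) ys ∨ hasPair a ys

contains132 : List ℕ → Bool
contains132 []       = false
contains132 (a ∷ xs) = hasPair a xs ∨ contains132 xs

adjOK : ℕ → List ℕ → Bool
adjOK m (a ∷ b ∷ xs) = (∣ a - b ∣ ℕ.≤ᵇ m) ∧ adjOK m (b ∷ xs)
adjOK m _            = true

av132 : ℕ → List (List ℕ)
av132 n = filterᵇ (λ π → not (contains132 π)) (perms n)

A : ℕ → ℕ → List (List ℕ)
A m n = filterᵇ (adjOK m) (av132 n)

data Thr : Set where
  fin : ℤ → Thr
  ∞   : Thr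

_-ᵗ_ : Thr → ℕ → Thr
fin z -ᵗ r = fin (z - + r)
∞     -ᵗ r = ∞

leThr : ℤ → Thr → Bool
leThr d (fin u) = d ℤ.≤ᵇ u
leThr d ∞       = true

data InB (m : ℕ) : Thr → Set where
  inB-fin : (j : ℕ) → j ℕ.< m → InB m (fin (+ j))
  inB-∞   : InB m ∞

firstE : List ℕ → ℕ
firstE []      = 0
firstE (x ∷ _) = x

lastE : List ℕ → ℕ
lastE []           = 0
lastE (x ∷ [])     = x
lastE (_ ∷ y ∷ ys) = lastE (y ∷ ys)

T : ℕ → Thr → Thr → ℕ → ℕ
T m u v n = length (filterᵇ (λ π → leThr (+ n - + firstE π) u ∧ leThr (+ n - + lastE π) v) (A m n))

c : ℕ → Thr → ℕ
c (suc zero) p = 1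
c k          p = length (filterᵇ (λ σ → leThr (+ k - + firstE σ) p) (av132 (k ∸ 1)))

sumFrom1 : ℕ → (ℕ → ℕ) → ℕ
sumFrom1 zero    f = 0
sumFrom1 (suc N) f = sumFrom1 N f ℕ.+ f (suc N)

-- Write π ∈ 𝒜ₙ as α n β.  Avoiding 132 forces every entry of α above every entry of β, so β is a
-- 132-avoiding permutation of {1, …, j} with j = |β|, and α one of {j + 1, …, n - 1}.
-- If β = [], then α ∈ 𝒜ₙ₋₁ and the conditions on π become n - 1 - α₁ ≤ p - 1 and, through the step
-- from the last entry of α up to n, n - 1 - α_last ≤ m - 1: this is the last term of the recurrence.
-- Otherwise let k = |α| + 1.  The step from n down to β₁ ≤ j = n - k forces k ≤ m; then α n lies in a
-- window of width k - 1 < m, so α is constrained only by n - α₁ ≤ p, i.e. k - σ₁ ≤ p for the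
-- standardisation σ of α, which gives the factor c_{k,p}; and β ∈ 𝒜ₙ₋ₖ is subject to
-- (n - k) - β₁ ≤ m - k and (n - k) - β_last ≤ q - k.  Both sides are compared as duplicate-free lists
-- with the same members.

module Submission where

open import Defs
open import Data.Bool using (Bool; true; false; _∧_; _∨_; not) renaming (T to Tᵇ)
open import Data.Bool.Properties using (T-∧; T-∨; ∧-assoc; ∧-identityʳ)
open import Data.Bool.ListAction using (any)
open import Data.Empty using (⊥-elim)
open import Data.Integer as ℤ using (ℤ; +_; _-_)
import Data.Integer.Properties as ℤ
open import Data.Integer.Tactic.RingSolver using (solve-∀)
open import Data.List
  using (List; []; _∷_; _++_; [_]; _∷ʳ_; length; map; concatMap; filter; filterᵇ; upTo; applyUpTo;
         cartesianProductWith)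
open import Data.List.Membership.Propositional using (_∈_; _∉_)
open import Data.List.Membership.Propositional.Properties
  using (∈-filter⁺; ∈-filter⁻; ∈-map⁺; ∈-map⁻; ∈-upTo⁺; ∈-upTo⁻; ∈-applyUpTo⁺; ∈-++⁺ˡ; ∈-++⁺ʳ; ∈-++⁻;
         ∈-∃++; ∈-cartesianProductWith⁺; ∈-cartesianProductWith⁻)
open import Data.List.Membership.Propositional.Properties.WithK using (unique∧set⇒bag)
open import Data.List.Properties
  using (length-filter; length-applyUpTo; length-map; length-++; map-∘; map-id-local; map-injective;
         ∷-injective; ∷ʳ-injectiveˡ)
open import Data.List.Relation.Binary.BagAndSetEquality using (∼bag⇒↭)
open import Data.List.Relation.Binary.Disjoint.Propositional using (Disjoint)
open import Data.List.Relation.Binary.Permutation.Propositional.Properties using (↭-length)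
open import Data.List.Relation.Binary.Subset.Propositional using (_⊆_)
open import Data.List.Relation.Unary.All as All using (All; []; _∷_)
import Data.List.Relation.Unary.All.Properties as All
open import Data.List.Relation.Unary.AllPairs as AllPairs using (AllPairs; []; _∷_)
import Data.List.Relation.Unary.AllPairs.Properties as AllPairs
open import Data.List.Relation.Unary.Any using (here; there)
import Data.List.Relation.Unary.Any.Properties as Any
open import Data.List.Relation.Unary.Unique.Propositional using (Unique)
import Data.List.Relation.Unary.Unique.Propositional.Properties as Unique
open import Data.Nat
  using (ℕ; zero; suc; _+_; _*_; _∸_; _≤_; _<_; _≟_; _⊓_; _≡ᵇ_; _<ᵇ_; _≤ᵇ_; ∣_-_∣;
         z≤n; s≤s; s≤s⁻¹; z<s)
open import Data.Nat.Properties
open import Data.List.Membership.DecPropositional _≟_ using (_∈?_)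
open import Data.Product using (_×_; _,_; proj₁; proj₂; ∃₂; ∃-syntax)
open import Data.Sum using (inj₁; inj₂; [_,_]′)
open import Data.Unit using (⊤; tt)
open import Function using (_∘_; id)
open import Function.Bundles using (_⇔_; mk⇔; Equivalence)
open import Relation.Binary.PropositionalEquality
  using (_≡_; _≢_; refl; sym; trans; cong; cong₂; subst; subst₂; module ≡-Reasoning)
open import Relation.Nullary using (¬_; yes; no; contradiction; contraposition)
open import Relation.Nullary.Decidable using (T?)

open Equivalence using (to; from)

private variable
  X Y Z : Set
  xs ys : List X

length≡0⇒[] : ∀ (xs : List X) → length xs ≡ 0 → xs ≡ []
length≡0⇒[] [] _ = refl

Unique-length-≡ : Unique xs → Unique ys → (∀ {z} → z ∈ xs ⇔ z ∈ ys) → length xs ≡ length ys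
Unique-length-≡ xs! ys! xs≈ys = ↭-length (∼bag⇒↭ (unique∧set⇒bag xs! ys! xs≈ys))

Unique-length-≤ : {xs ys : List ℕ} → Unique xs → Unique ys → xs ⊆ ys → length xs ≤ length ys
Unique-length-≤ {xs} {ys} xs! ys! xs⊆ys = begin
  length xs                   ≡⟨ Unique-length-≡ xs! (Unique.filter⁺ (_∈? xs) ys!) xs≈ ⟩
  length (filter (_∈? xs) ys) ≤⟨ length-filter (_∈? xs) ys ⟩
  length ys                   ∎
  where
  open ≤-Reasoning
  xs≈ : ∀ {z} → z ∈ xs ⇔ z ∈ filter (_∈? xs) ys
  xs≈ = mk⇔ (λ z∈xs → ∈-filter⁺ (_∈? xs) (xs⊆ys z∈xs) z∈xs)
            (λ z∈ → proj₂ (∈-filter⁻ (_∈? xs) {xs = ys} z∈))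

Unique-length-between : ∀ {lo hi} {xs : List ℕ} → lo < hi → Unique xs → All (λ x → lo < x × x < hi) xs →
                        lo + length xs < hi
Unique-length-between {lo} {hi} {xs} lo<hi xs! bounds = begin
  suc lo + length xs      ≡⟨ +-comm (suc lo) (length xs) ⟩
  length xs + suc lo      ≤⟨ m≤o∸n⇒m+n≤o (length xs) lo<hi length≤ ⟩
  hi                      ∎
  where
  open ≤-Reasoning
  interval : List ℕ
  interval = applyUpTo (_+_ (suc lo)) (hi ∸ suc lo)
  interval! : Unique interval
  interval! = Unique.applyUpTo⁺₁ (_+_ (suc lo)) (hi ∸ suc lo) (λ i<j _ → <⇒≢ (+-monoʳ-< (suc lo) i<j))
  xs⊆interval : xs ⊆ interval
  xs⊆interval x∈xs with lo<x , x<hi ← All.lookup bounds x∈xs =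
    subst (_∈ interval) (m+[n∸m]≡n lo<x) (∈-applyUpTo⁺ (_+_ (suc lo)) (∸-monoˡ-< x<hi lo<x))
  length≤ : length xs ≤ hi ∸ suc lo
  length≤ = ≤-trans (Unique-length-≤ xs! interval! xs⊆interval) (≤-reflexive (length-applyUpTo _ (hi ∸ suc lo)))

Unique-++⁻ : ∀ (xs : List X) {ys} → Unique (xs ++ ys) → Unique xs × Unique ys × Disjoint xs ys
Unique-++⁻ []       ys!          = [] , ys! , λ ()
Unique-++⁻ (x ∷ xs) (x∉ ∷ xs++ys!) with xs! , ys! , xs#ys ← Unique-++⁻ xs xs++ys! =
  All.++⁻ˡ xs x∉ ∷ xs! , ys! ,
  λ { (here refl , x∈ys)  → All.lookup (All.++⁻ʳ xs x∉) x∈ys refl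
    ; (there z∈xs , z∈ys) → xs#ys (z∈xs , z∈ys) }

++-∷-injective : ∀ {y : X} (xs xs′ : List X) {ys ys′} → y ∉ xs → y ∉ xs′ →
                 xs ++ y ∷ ys ≡ xs′ ++ y ∷ ys′ → xs ≡ xs′ × ys ≡ ys′
++-∷-injective []       []        _   _    eq = refl , proj₂ (∷-injective eq)
++-∷-injective []       (x′ ∷ xs′) _   y∉xs′ eq = contradiction (here (proj₁ (∷-injective eq))) y∉xs′
++-∷-injective (x ∷ xs) []        y∉xs _    eq = contradiction (here (sym (proj₁ (∷-injective eq)))) y∉xs
++-∷-injective (x ∷ xs) (x′ ∷ xs′) y∉xs y∉xs′ eq
  with refl , eq′ ← ∷-injective eq
  with refl , refl ← ++-∷-injective xs xs′ (y∉xs ∘ there) (y∉xs′ ∘ there) eq′ = refl , refl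

Unique-map⁺-on : (f : X → Y) → (∀ {x y} → x ∈ xs → y ∈ xs → f x ≡ f y → x ≡ y) →
                 Unique xs → Unique (map f xs)
Unique-map⁺-on f f-inj []           = []
Unique-map⁺-on f f-inj (x∉xs ∷ xs!) =
  All.map⁺ (All.tabulate λ y∈xs fx≡fy → All.lookup x∉xs y∈xs (f-inj (here refl) (there y∈xs) fx≡fy))
  ∷ Unique-map⁺-on f (λ x∈ y∈ → f-inj (there x∈) (there y∈)) xs!

Unique-cartesianProductWith⁺-on : (f : X → Y → Z) →
  (∀ {w x y z} → w ∈ xs → x ∈ xs → y ∈ ys → z ∈ ys → f w y ≡ f x z → w ≡ x × y ≡ z) →
  Unique xs → Unique ys → Unique (cartesianProductWith f xs ys)
Unique-cartesianProductWith⁺-on f f-inj [] ys! = []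
Unique-cartesianProductWith⁺-on {xs = x ∷ xs} {ys} f f-inj (x∉xs ∷ xs!) ys! =
  Unique.++⁺ (Unique-map⁺-on (f x) (λ y∈ z∈ → proj₂ ∘ f-inj (here refl) (here refl) y∈ z∈) ys!)
             (Unique-cartesianProductWith⁺-on f (λ w∈ x∈ → f-inj (there w∈) (there x∈)) xs! ys!)
             disjoint
  where
  disjoint : Disjoint (map (f x) ys) (cartesianProductWith f xs ys)
  disjoint (v∈map , v∈prod)
    with y , y∈ , refl ← ∈-map⁻ (f x) v∈map
    with x′ , y′ , x′∈ , y′∈ , eq ← ∈-cartesianProductWith⁻ f xs ys v∈prod =
    All.lookup x∉xs x′∈ (proj₁ (f-inj (here refl) (there x′∈) y∈ y′∈ eq))

length-cartesianProductWith : (f : X → Y → Z) (xs : List X) (ys : List Y) →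
                              length (cartesianProductWith f xs ys) ≡ length xs * length ys
length-cartesianProductWith f []       ys = refl
length-cartesianProductWith f (x ∷ xs) ys = begin
  length (map (f x) ys ++ cartesianProductWith f xs ys)
    ≡⟨ length-++ (map (f x) ys) ⟩
  length (map (f x) ys) + length (cartesianProductWith f xs ys)
    ≡⟨ cong₂ _+_ (length-map (f x) ys) (length-cartesianProductWith f xs ys) ⟩
  length ys + length xs * length ys
    ∎
  where open ≡-Reasoning

concatMap-map≡cartesianProductWith : (f : X → Y → Z) (xs : List X) (ys : List Y) →
                                     concatMap (λ x → map (f x) ys) xs ≡ cartesianProductWith f xs ys
concatMap-map≡cartesianProductWith f []       ys = refl
concatMap-map≡cartesianProductWith f (x ∷ xs) ys =
  cong (map (f x) ys ++_) (concatMap-map≡cartesianProductWith f xs ys)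

sumFrom1-cong : ∀ K {f g : ℕ → ℕ} → (∀ k → f k ≡ g k) → sumFrom1 K f ≡ sumFrom1 K g
sumFrom1-cong zero    f≗g = refl
sumFrom1-cong (suc K) f≗g = cong₂ _+_ (sumFrom1-cong K f≗g) (f≗g (suc K))

concatFrom1 : ℕ → (ℕ → List X) → List X
concatFrom1 zero    f = []
concatFrom1 (suc K) f = concatFrom1 K f ++ f (suc K)

length-concatFrom1 : ∀ K (f : ℕ → List X) → length (concatFrom1 K f) ≡ sumFrom1 K (length ∘ f)
length-concatFrom1 zero    f = refl
length-concatFrom1 (suc K) f =
  trans (length-++ (concatFrom1 K f)) (cong (_+ length (f (suc K))) (length-concatFrom1 K f))

∈-concatFrom1⁻ : ∀ K (f : ℕ → List X) {x} → x ∈ concatFrom1 K f → ∃[ k ] suc k ≤ K × x ∈ f (suc k)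
∈-concatFrom1⁻ (suc K) f x∈ with ∈-++⁻ (concatFrom1 K f) x∈
... | inj₁ x∈f₁…K with k , k<K , x∈fk ← ∈-concatFrom1⁻ K f x∈f₁…K = k , m≤n⇒m≤1+n k<K , x∈fk
... | inj₂ x∈fK = K , ≤-refl , x∈fK

∈-concatFrom1⁺ : ∀ K (f : ℕ → List X) {k x} → suc k ≤ K → x ∈ f (suc k) → x ∈ concatFrom1 K f
∈-concatFrom1⁺ (suc K) f {k} k<1+K x∈fk with k ≟ K
... | yes refl = ∈-++⁺ʳ (concatFrom1 K f) x∈fk
... | no  k≢K  = ∈-++⁺ˡ (∈-concatFrom1⁺ K f (≤∧≢⇒< (s≤s⁻¹ k<1+K) k≢K) x∈fk)

Unique-concatFrom1 : ∀ K (f : ℕ → List X) →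
  (∀ {k} → suc k ≤ K → Unique (f (suc k))) →
  (∀ {k k′ x} → suc k ≤ K → suc k′ ≤ K → x ∈ f (suc k) → x ∈ f (suc k′) → k ≡ k′) →
  Unique (concatFrom1 K f)
Unique-concatFrom1 zero    f f! f-disj = []
Unique-concatFrom1 (suc K) f f! f-disj =
  Unique.++⁺ (Unique-concatFrom1 K f (f! ∘ m≤n⇒m≤1+n)
                                  (λ k<K k′<K → f-disj (m≤n⇒m≤1+n k<K) (m≤n⇒m≤1+n k′<K)))
             (f! ≤-refl)
             λ (x∈f₁…K , x∈fK) → let k , k<K , x∈fk = ∈-concatFrom1⁻ K f x∈f₁…K in
                                  <⇒≢ k<K (f-disj (m≤n⇒m≤1+n k<K) ≤-refl x∈fk x∈fK)

¬-cong : {P Q : Set} → P ⇔ Q → (¬ P) ⇔ (¬ Q)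
¬-cong P⇔Q = mk⇔ (contraposition (from P⇔Q)) (contraposition (to P⇔Q))

T-not⇔¬T : ∀ {b} → Tᵇ (not b) ⇔ (¬ Tᵇ b)
T-not⇔¬T {false} = mk⇔ (λ _ ()) (λ _ → tt)
T-not⇔¬T {true}  = mk⇔ (λ ()) (λ ¬t → ¬t tt)

¬T-∨ : ∀ {a b} → (¬ Tᵇ (a ∨ b)) ⇔ (¬ Tᵇ a × ¬ Tᵇ b)
¬T-∨ = mk⇔ (λ ¬a∨b → ¬a∨b ∘ from T-∨ ∘ inj₁ , ¬a∨b ∘ from T-∨ ∘ inj₂)
           (λ (¬a , ¬b) a∨b → [ ¬a , ¬b ]′ (to T-∨ a∨b))

¬T-any : (p : X → Bool) (xs : List X) → (¬ Tᵇ (any p xs)) ⇔ All (λ x → ¬ Tᵇ (p x)) xs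
¬T-any p xs = mk⇔ (All.¬Any⇒All¬ xs ∘ contraposition (Any.any⁺ p))
                  (λ all¬ → All.All¬⇒¬Any all¬ ∘ Any.any⁻ p xs)

∈-filterᵇ⇔ : (p : X → Bool) {x : X} → x ∈ filterᵇ p xs ⇔ (x ∈ xs × Tᵇ (p x))
∈-filterᵇ⇔ p = mk⇔ (∈-filter⁻ (T? ∘ p)) (λ (x∈ , px) → ∈-filter⁺ (T? ∘ p) x∈ px)

T-<ᵇ∧<ᵇ⇔ : ∀ a b c → Tᵇ ((a <ᵇ c) ∧ (c <ᵇ b)) ⇔ (a < c × c < b)
T-<ᵇ∧<ᵇ⇔ a b c = mk⇔ (λ t → let ac , cb = to T-∧ t in <ᵇ⇒< a c ac , <ᵇ⇒< c b cb)
                     (λ (a<c , c<b) → from T-∧ (<⇒<ᵇ a<c , <⇒<ᵇ c<b))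

T-≤ᵇ⇔ : ∀ a b → Tᵇ (a ≤ᵇ b) ⇔ a ≤ b
T-≤ᵇ⇔ a b = mk⇔ (≤ᵇ⇒≤ a b) ≤⇒≤ᵇ

T-injective : ∀ {a b} → Tᵇ a ⇔ Tᵇ b → a ≡ b
T-injective {false} {false} _   = refl
T-injective {false} {true}  a⇔b = ⊥-elim (from a⇔b tt)
T-injective {true}  {false} a⇔b = ⊥-elim (to a⇔b tt)
T-injective {true}  {true}  _   = refl

-- Permutations and 132-avoidance

record IsPermOf (lo l : ℕ) (xs : List ℕ) : Set where
  constructor isPermOf
  field
    length≡ : length xs ≡ l
    bounds  : All (λ x → lo < x × x ≤ lo + l) xs
    unique  : Unique xs

IsPerm : ℕ → List ℕ → Set
IsPerm = IsPermOf 0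

Avoids132 : List ℕ → Set
Avoids132 []       = ⊤
Avoids132 (a ∷ xs) = AllPairs (λ b c → ¬ (a < c × c < b)) xs × Avoids132 xs

Unique⇔T-nodup : ∀ π → Unique π ⇔ Tᵇ (nodup π)
Unique⇔T-nodup []      = mk⇔ (λ _ → tt) (λ _ → [])
Unique⇔T-nodup (x ∷ π) = mk⇔
  (λ { (x∉π ∷ π!) → from T-∧ (from T-not⇔¬T (from (¬T-any _ π) (All.map ≢⇒¬T x∉π)) ,
                              to (Unique⇔T-nodup π) π!) })
  (λ t → let fresh , π! = to T-∧ t in
         All.map ¬T⇒≢ (to (¬T-any _ π) (to T-not⇔¬T fresh)) ∷ from (Unique⇔T-nodup π) π!)
  where
  ≢⇒¬T : ∀ {y} → x ≢ y → ¬ Tᵇ (x ≡ᵇ y)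
  ≢⇒¬T {y} x≢y = x≢y ∘ ≡ᵇ⇒≡ x y
  ¬T⇒≢ : ∀ {y} → ¬ Tᵇ (x ≡ᵇ y) → x ≢ y
  ¬T⇒≢ {y} ¬t = ¬t ∘ ≡⇒≡ᵇ x y

∈-letters⇔ : ∀ a {x} → x ∈ map suc (upTo a) ⇔ (1 ≤ x × x ≤ a)
∈-letters⇔ a {x} = mk⇔ letter⁻ letter⁺
  where
  letter⁻ : x ∈ map suc (upTo a) → 1 ≤ x × x ≤ a
  letter⁻ x∈ with y , y∈ , refl ← ∈-map⁻ suc x∈ = s≤s z≤n , ∈-upTo⁻ y∈
  letter⁺ : 1 ≤ x × x ≤ a → x ∈ map suc (upTo a)
  letter⁺ (s≤s {n = y} _ , y<a) = ∈-map⁺ suc (∈-upTo⁺ y<a)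

words-suc : ∀ a l → words a (suc l) ≡ cartesianProductWith _∷_ (map suc (upTo a)) (words a l)
words-suc a l = concatMap-map≡cartesianProductWith _∷_ (map suc (upTo a)) (words a l)

∈-words⇔ : ∀ a l {w} → w ∈ words a l ⇔ (length w ≡ l × All (λ x → 1 ≤ x × x ≤ a) w)
∈-words⇔ a zero    {w} = mk⇔ (λ { (here refl) → refl , [] }) (λ (len , _) → here (length≡0⇒[] w len))
∈-words⇔ a (suc l) = mk⇔ to′ from′
  where
  to′ : ∀ {w} → w ∈ words a (suc l) → length w ≡ suc l × All (λ x → 1 ≤ x × x ≤ a) w
  to′ w∈ rewrite words-suc a l
    with x , w′ , x∈ , w′∈ , refl ← ∈-cartesianProductWith⁻ _∷_ (map suc (upTo a)) (words a l) w∈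
    with len , bounds ← to (∈-words⇔ a l) w′∈ = cong suc len , to (∈-letters⇔ a) x∈ ∷ bounds
  from′ : ∀ {w} → length w ≡ suc l × All (λ x → 1 ≤ x × x ≤ a) w → w ∈ words a (suc l)
  from′ {x ∷ w′} (len , x-bounds ∷ bounds) rewrite words-suc a l =
    ∈-cartesianProductWith⁺ _∷_ (from (∈-letters⇔ a) x-bounds) (from (∈-words⇔ a l) (suc-injective len , bounds))

Unique-words : ∀ a l → Unique (words a l)
Unique-words a zero    = [] ∷ []
Unique-words a (suc l) rewrite words-suc a l =
  Unique.cartesianProductWith⁺ _∷_ ∷-injective (Unique.map⁺ suc-injective (Unique.upTo⁺ a)) (Unique-words a l)

∈-perms⇔ : ∀ n {π} → π ∈ perms n ⇔ IsPerm n π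
∈-perms⇔ n {π} = mk⇔
  (λ π∈ → let π∈words , π! = to (∈-filterᵇ⇔ nodup) π∈ ; len , bounds = to (∈-words⇔ n n) π∈words
          in isPermOf len bounds (from (Unique⇔T-nodup π) π!))
  (λ (isPermOf len bounds π!) →
     from (∈-filterᵇ⇔ nodup) (from (∈-words⇔ n n) (len , bounds) , to (Unique⇔T-nodup π) π!))

Unique-perms : ∀ n → Unique (perms n)
Unique-perms n = Unique.filter⁺ _ (Unique-words n n)

AllPairs⇔¬T-hasPair : ∀ a ys → AllPairs (λ b c → ¬ (a < c × c < b)) ys ⇔ (¬ Tᵇ (hasPair a ys))
AllPairs⇔¬T-hasPair a []       = mk⇔ (λ _ ()) (λ _ → [])
AllPairs⇔¬T-hasPair a (b ∷ ys) = mk⇔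
  (λ { (row ∷ pairs) → from ¬T-∨ (from (¬T-any _ ys) (All.map (from (¬-cong (T-<ᵇ∧<ᵇ⇔ a b _))) row) ,
                                  to (AllPairs⇔¬T-hasPair a ys) pairs) })
  (λ ¬t → let ¬row , ¬pairs = to ¬T-∨ ¬t in
          All.map (to (¬-cong (T-<ᵇ∧<ᵇ⇔ a b _))) (to (¬T-any _ ys) ¬row) ∷
          from (AllPairs⇔¬T-hasPair a ys) ¬pairs)

Avoids132⇔¬T-contains132 : ∀ π → Avoids132 π ⇔ (¬ Tᵇ (contains132 π))
Avoids132⇔¬T-contains132 []      = mk⇔ (λ _ ()) (λ _ → tt)
Avoids132⇔¬T-contains132 (a ∷ π) = mk⇔
  (λ (pairs , av) → from ¬T-∨ (to (AllPairs⇔¬T-hasPair a π) pairs , to (Avoids132⇔¬T-contains132 π) av))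
  (λ ¬t → let ¬pairs , ¬av = to ¬T-∨ ¬t in
          from (AllPairs⇔¬T-hasPair a π) ¬pairs , from (Avoids132⇔¬T-contains132 π) ¬av)

∈-av132⇔ : ∀ n {π} → π ∈ av132 n ⇔ (IsPerm n π × Avoids132 π)
∈-av132⇔ n {π} = mk⇔
  (λ π∈ → let π∈perms , t = to (∈-filterᵇ⇔ _) π∈ in
          to (∈-perms⇔ n) π∈perms , from (Avoids132⇔¬T-contains132 π) (to T-not⇔¬T t))
  (λ (perm , av) →
     from (∈-filterᵇ⇔ _) (from (∈-perms⇔ n) perm , from T-not⇔¬T (to (Avoids132⇔¬T-contains132 π) av)))

Unique-av132 : ∀ n → Unique (av132 n)
Unique-av132 n = Unique.filter⁺ _ (Unique-perms n)

∈-A⇔ : ∀ m n {π} → π ∈ A m n ⇔ ((IsPerm n π × Avoids132 π) × Tᵇ (adjOK m π))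
∈-A⇔ m n = mk⇔ (λ π∈ → let π∈av , adj = to (∈-filterᵇ⇔ _) π∈ in to (∈-av132⇔ n) π∈av , adj)
                (λ (perm-av , adj) → from (∈-filterᵇ⇔ _) (from (∈-av132⇔ n) perm-av , adj))

Unique-A : ∀ m n → Unique (A m n)
Unique-A m n = Unique.filter⁺ _ (Unique-av132 n)

AllPairs-++⁻ : ∀ {R : X → X → Set} xs {ys} → AllPairs R (xs ++ ys) →
               AllPairs R xs × AllPairs R ys × All (λ x → All (R x) ys) xs
AllPairs-++⁻ []       pairs          = [] , pairs , []
AllPairs-++⁻ (x ∷ xs) (row ∷ pairs) with xs-pairs , ys-pairs , cross ← AllPairs-++⁻ xs pairs =
  All.++⁻ˡ xs row ∷ xs-pairs , ys-pairs , All.++⁻ʳ xs row ∷ cross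

AllPairs-from-All : ∀ {R : X → X → Set} {P : X → Set} → (∀ {b c} → P c → R b c) → All P xs → AllPairs R xs
AllPairs-from-All P⇒R []         = []
AllPairs-from-All P⇒R (_ ∷ all) = All.map P⇒R all ∷ AllPairs-from-All P⇒R all

Avoids132-++-∷⁻ : ∀ y xs {ys} → All (_< y) ys → Avoids132 (xs ++ y ∷ ys) →
                  Avoids132 xs × Avoids132 ys × All (λ x → All (_≤ x) ys) xs
Avoids132-++-∷⁻ y []       ys<y (_ , av-ys) = tt , av-ys , []
Avoids132-++-∷⁻ y (x ∷ xs) ys<y (pairs , av)
  with xs-pairs , y-row ∷ _ , _ ← AllPairs-++⁻ xs pairs
  with av-xs , av-ys , cross ← Avoids132-++-∷⁻ y xs ys<y av =
  (xs-pairs , av-xs) , av-ys ,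
  All.zipWith (λ (¬x<c<y , c<y) → ≮⇒≥ (λ x<c → ¬x<c<y (x<c , c<y))) (y-row , ys<y) ∷ cross

Avoids132-++-∷⁺ : ∀ y xs {ys} → All (_< y) xs → All (_< y) ys → Avoids132 xs → Avoids132 ys →
                  All (λ x → All (_≤ x) ys) xs → Avoids132 (xs ++ y ∷ ys)
Avoids132-++-∷⁺ y []       _            ys<y _              av-ys _ =
  AllPairs-from-All (λ c<y (y<c , _) → <-asym c<y y<c) ys<y , av-ys
Avoids132-++-∷⁺ y (x ∷ xs) (_ ∷ xs<y) ys<y (xs-pairs , av-xs) av-ys (ys≤x ∷ cross) =
  AllPairs.++⁺ xs-pairs (All.map below-x ys≤x ∷ AllPairs-from-All below-x ys≤x)
               (All.map (λ a<y → (λ (_ , y<a) → <-asym a<y y<a) ∷ All.map below-x ys≤x) xs<y) ,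
  Avoids132-++-∷⁺ y xs xs<y ys<y av-xs av-ys cross
  where
  below-x : ∀ {b c} → c ≤ x → ¬ (x < c × c < b)
  below-x c≤x (x<c , _) = <⇒≱ x<c c≤x

Avoids132-map : (f : ℕ → ℕ) → (∀ {a b} → f a < f b ⇔ a < b) → ∀ xs → Avoids132 (map f xs) ⇔ Avoids132 xs
Avoids132-map f f-< []       = mk⇔ id id
Avoids132-map f f-< (a ∷ xs) = mk⇔
  (λ (pairs , av) → AllPairs.map (contraposition pattern⁺) (AllPairs.map⁻ pairs) , to (Avoids132-map f f-< xs) av)
  (λ (pairs , av) → AllPairs.map⁺ (AllPairs.map (contraposition pattern⁻) pairs) , from (Avoids132-map f f-< xs) av)
  where
  pattern⁺ : ∀ {b c} → a < c × c < b → f a < f c × f c < f b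
  pattern⁺ (a<c , c<b) = from f-< a<c , from f-< c<b
  pattern⁻ : ∀ {b c} → f a < f c × f c < f b → a < c × c < b
  pattern⁻ (a<c , c<b) = to f-< a<c , to f-< c<b

-- Shifts and maxima of permutations

shift : ℕ → List ℕ → List ℕ
shift j = map (_+_ j)

Avoids132-shift : ∀ j σ → Avoids132 (shift j σ) ⇔ Avoids132 σ
Avoids132-shift j = Avoids132-map (_+_ j) (mk⇔ (+-cancelˡ-< j _ _) (+-monoʳ-< j))

IsPerm-shift : ∀ j {l σ} → IsPerm l σ → IsPermOf j l (shift j σ)
IsPerm-shift j {σ = σ} (isPermOf len bounds σ!) =
  isPermOf (trans (length-map (_+_ j) σ) len)
           (All.map⁺ (All.map (λ (0<s , s≤l) → m<m+n j 0<s , +-monoʳ-≤ j s≤l) bounds))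
           (Unique.map⁺ (+-cancelˡ-≡ j _ _) σ!)

IsPermOf-unshift : ∀ {j l α} → IsPermOf j l α → ∃[ σ ] α ≡ shift j σ × IsPerm l σ
IsPermOf-unshift {j} {l} {α} (isPermOf len bounds α!) =
  map (_∸ j) α ,
  sym (trans (sym (map-∘ α)) (map-id-local (All.map (λ (j<x , _) → m+[n∸m]≡n (<⇒≤ j<x)) bounds))) ,
  isPermOf (trans (length-map (_∸ j) α) len)
           (All.map⁺ (All.map (λ (j<x , x≤j+l) → m<n⇒0<n∸m j<x , m≤n+o⇒m∸n≤o _ j x≤j+l) bounds))
           (Unique-map⁺-on (_∸ j) ∸j-injective α!)
  where
  ∸j-injective : ∀ {x y} → x ∈ α → y ∈ α → x ∸ j ≡ y ∸ j → x ≡ y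
  ∸j-injective {x} {y} x∈ y∈ eq = begin
    x             ≡⟨ m+[n∸m]≡n (<⇒≤ (proj₁ (All.lookup bounds x∈))) ⟨
    j + (x ∸ j)   ≡⟨ cong (_+_ j) eq ⟩
    j + (y ∸ j)   ≡⟨ m+[n∸m]≡n (<⇒≤ (proj₁ (All.lookup bounds y∈))) ⟩
    y             ∎
    where open ≡-Reasoning

All-<-∉ : ∀ {n} {xs : List ℕ} → All (_≤ n) xs → n ∉ xs → All (_< n) xs
All-<-∉ xs≤n n∉xs = All.tabulate λ x∈ → ≤∧≢⇒< (All.lookup xs≤n x∈) (λ { refl → n∉xs x∈ })

IsPerm-∋-max : ∀ {n π} → IsPerm (suc n) π → suc n ∈ π
IsPerm-∋-max {n} {π} (isPermOf len bounds π!) with suc n ∈? π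
... | yes n∈π = n∈π
... | no  n∉π = contradiction (subst (_≤ n) len (s≤s⁻¹ (Unique-length-between (s≤s z≤n) π! inside))) 1+n≰n
  where
  inside : All (λ x → 0 < x × x < suc n) π
  inside = All.zipWith (λ ((0<x , _) , x<1+n) → 0<x , x<1+n) (bounds , All-<-∉ (All.map proj₂ bounds) n∉π)

length-split : ∀ {n} α β → IsPerm n (α ++ n ∷ β) → n ≡ suc (length α) + length β
length-split α β perm = trans (sym (IsPermOf.length≡ perm)) (trans (length-++ α) (+-suc (length α) (length β)))

IsPerm-split-at-max : ∀ α β {n} → IsPerm n (α ++ n ∷ β) → Avoids132 (α ++ n ∷ β) →
                      IsPermOf (length β) (length α) α × IsPerm (length β) β × Avoids132 α × Avoids132 β
IsPerm-split-at-max α β {n} perm@(isPermOf _ bounds π!) av =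
  isPermOf refl (All.tabulate α-bounds) α! , isPermOf refl (All.tabulate β-bounds) β! , av-α , av-β
  where
  j = length β
  l = length α
  n≡ : n ≡ suc (l + j)
  n≡ = length-split α β perm
  α! = proj₁ (Unique-++⁻ α π!)
  n∉β = Unique.Unique[x∷xs]⇒x∉xs (proj₁ (proj₂ (Unique-++⁻ α π!)))
  β!  = AllPairs.tail (proj₁ (proj₂ (Unique-++⁻ α π!)))
  α#n∷β = proj₂ (proj₂ (Unique-++⁻ α π!))
  α-in = proj₁ (All.++⁻ α bounds)
  β-in = All.tail (proj₂ (All.++⁻ α bounds))
  α<n = All-<-∉ (All.map proj₂ α-in) (λ n∈α → α#n∷β (n∈α , here refl))
  β<n = All-<-∉ (All.map proj₂ β-in) n∉β
  parts = Avoids132-++-∷⁻ n α β<n av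
  av-α = proj₁ parts
  av-β = proj₁ (proj₂ parts)
  β<α : ∀ {x y} → x ∈ α → y ∈ β → y < x
  β<α x∈ y∈ = ≤∧≢⇒< (All.lookup (All.lookup (proj₂ (proj₂ parts)) x∈) y∈) (λ { refl → α#n∷β (x∈ , there y∈) })
  -- The j distinct entries of β lie in (0, x) for each x ∈ α, and the l distinct entries of α
  -- lie in (y, n) for each y ∈ β.
  α-bounds : ∀ {x} → x ∈ α → j < x × x ≤ j + l
  α-bounds x∈ = Unique-length-between {lo = 0} (proj₁ (All.lookup α-in x∈)) β!
                  (All.tabulate λ y∈ → proj₁ (All.lookup β-in y∈) , β<α x∈ y∈) ,
                s≤s⁻¹ (subst (_ <_) (trans n≡ (cong suc (+-comm l j))) (All.lookup α<n x∈))
  β-bounds : ∀ {y} → y ∈ β → 0 < y × y ≤ j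
  β-bounds {y} y∈ =
    proj₁ (All.lookup β-in y∈) ,
    s≤s⁻¹ (+-cancelʳ-< l y (suc j)
             (subst (y + l <_) (trans n≡ (cong suc (+-comm l j)))
                    (Unique-length-between (All.lookup β<n y∈) α!
                                           (All.tabulate λ x∈ → β<α x∈ y∈ , All.lookup α<n x∈))))

IsPerm-join-at-max : ∀ {j l α β} n → n ≡ suc (j + l) → IsPermOf j l α → IsPerm j β →
                     Avoids132 α → Avoids132 β → IsPerm n (α ++ n ∷ β) × Avoids132 (α ++ n ∷ β)
IsPerm-join-at-max {j} {l} {α} {β} n n≡ (isPermOf α-len α-bounds α!) (isPermOf β-len β-bounds β!) av-α av-β =
  isPermOf length≡
           (All.++⁺ (All.map (λ (j<x , x≤j+l) → <-≤-trans z<s j<x , <⇒≤ (x<n x≤j+l)) α-bounds)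
                    ((x<n z≤n , ≤-refl) ∷ All.map (λ (0<y , y≤j) → 0<y , <⇒≤ (y<n y≤j)) β-bounds))
           (Unique.++⁺ α! (All.map (λ (_ , y≤j) → <⇒≢ (y<n y≤j) ∘ sym) β-bounds ∷ β!) disjoint) ,
  Avoids132-++-∷⁺ n α (All.map (x<n ∘ proj₂) α-bounds) (All.map (y<n ∘ proj₂) β-bounds) av-α av-β
    (All.map (λ (j<x , _) → All.map (λ (_ , y≤j) → <⇒≤ (≤-<-trans y≤j j<x)) β-bounds) α-bounds)
  where
  x<n : ∀ {x} → x ≤ j + l → x < n
  x<n x≤j+l = subst (_ <_) (sym n≡) (s≤s x≤j+l)
  y<n : ∀ {y} → y ≤ j → y < n
  y<n y≤j = x<n (≤-trans y≤j (m≤m+n j l))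
  length≡ : length (α ++ n ∷ β) ≡ n
  length≡ = begin
    length (α ++ n ∷ β)        ≡⟨ length-++ α ⟩
    length α + suc (length β)  ≡⟨ cong₂ (λ a b → a + suc b) α-len β-len ⟩
    l + suc j                  ≡⟨ +-suc l j ⟩
    suc (l + j)                ≡⟨ cong suc (+-comm l j) ⟩
    suc (j + l)                ≡⟨ n≡ ⟨
    n                          ∎
    where open ≡-Reasoning
  disjoint : Disjoint α (n ∷ β)
  disjoint (x∈ , here refl) = <⇒≢ (x<n (proj₂ (All.lookup α-bounds x∈))) refl
  disjoint (x∈ , there x∈β) = <⇒≱ (proj₁ (All.lookup α-bounds x∈)) (proj₂ (All.lookup β-bounds x∈β))

adjOK-++-∷ : ∀ m xs y ys → adjOK m (xs ++ y ∷ ys) ≡ adjOK m (xs ∷ʳ y) ∧ adjOK m (y ∷ ys)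
adjOK-++-∷ m []            y ys = refl
adjOK-++-∷ m (x ∷ [])      y ys = cong (_∧ adjOK m (y ∷ ys)) (sym (∧-identityʳ (∣ x - y ∣ ≤ᵇ m)))
adjOK-++-∷ m (x ∷ x′ ∷ xs) y ys = begin
  (∣ x - x′ ∣ ≤ᵇ m) ∧ adjOK m (x′ ∷ xs ++ y ∷ ys)                 ≡⟨ cong (_ ∧_) (adjOK-++-∷ m (x′ ∷ xs) y ys) ⟩
  (∣ x - x′ ∣ ≤ᵇ m) ∧ (adjOK m (x′ ∷ xs ∷ʳ y) ∧ adjOK m (y ∷ ys)) ≡⟨ ∧-assoc (∣ x - x′ ∣ ≤ᵇ m) _ _ ⟨
  ((∣ x - x′ ∣ ≤ᵇ m) ∧ adjOK m (x′ ∷ xs ∷ʳ y)) ∧ adjOK m (y ∷ ys) ∎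
  where open ≡-Reasoning

adjOK-∷ʳ : ∀ m x xs y → adjOK m ((x ∷ xs) ∷ʳ y) ≡ adjOK m (x ∷ xs) ∧ (∣ lastE (x ∷ xs) - y ∣ ≤ᵇ m)
adjOK-∷ʳ m x []        y = ∧-identityʳ (∣ x - y ∣ ≤ᵇ m)
adjOK-∷ʳ m x (x′ ∷ xs) y = trans (cong (_ ∧_) (adjOK-∷ʳ m x′ xs y)) (sym (∧-assoc (∣ x - x′ ∣ ≤ᵇ m) _ _))

adjOK-∷-∷⇔ : ∀ m x y ys → Tᵇ (adjOK m (x ∷ y ∷ ys)) ⇔ (∣ x - y ∣ ≤ m × Tᵇ (adjOK m (y ∷ ys)))
adjOK-∷-∷⇔ m x y ys = mk⇔ (λ t → let d , adj = to T-∧ t in to (T-≤ᵇ⇔ _ m) d , adj)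
                          (λ (d , adj) → from T-∧ (from (T-≤ᵇ⇔ _ m) d , adj))

∣-∣≤-interval : ∀ lo m {a b} → lo ≤ a × a ≤ lo + m → lo ≤ b × b ≤ lo + m → ∣ a - b ∣ ≤ m
∣-∣≤-interval lo m {a} {b} (lo≤a , a≤) (lo≤b , b≤) with ≤-total a b
... | inj₁ a≤b = subst (_≤ m) (sym (m≤n⇒∣m-n∣≡n∸m a≤b)) (≤-trans (∸-mono b≤ lo≤a) (≤-reflexive (m+n∸m≡n lo m)))
... | inj₂ b≤a = subst (_≤ m) (sym (m≤n⇒∣n-m∣≡n∸m b≤a)) (≤-trans (∸-mono a≤ lo≤b) (≤-reflexive (m+n∸m≡n lo m)))

adjOK-interval : ∀ m lo {xs} → All (λ x → lo ≤ x × x ≤ lo + m) xs → Tᵇ (adjOK m xs)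
adjOK-interval m lo []       = tt
adjOK-interval m lo (_ ∷ []) = tt
adjOK-interval m lo {x ∷ y ∷ ys} (x-in ∷ y-in ∷ rest) =
  from (adjOK-∷-∷⇔ m x y ys) (∣-∣≤-interval lo m x-in y-in , adjOK-interval m lo (y-in ∷ rest))

lastE-++-∷ : ∀ xs (y : ℕ) ys → lastE (xs ++ y ∷ ys) ≡ lastE (y ∷ ys)
lastE-++-∷ []            y ys = refl
lastE-++-∷ (x ∷ [])      y ys = refl
lastE-++-∷ (x ∷ x′ ∷ xs) y ys = lastE-++-∷ (x′ ∷ xs) y ys

lastE-∈ : ∀ x xs → lastE (x ∷ xs) ∈ x ∷ xs
lastE-∈ x []        = here refl
lastE-∈ x (x′ ∷ xs) = there (lastE-∈ x′ xs)

+m-+n≡+[m∸n] : ∀ {m n} → n ≤ m → + m - + n ≡ + (m ∸ n)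
+m-+n≡+[m∸n] {m} {n} n≤m = trans (ℤ.m-n≡m⊖n m n) (ℤ.⊖-≥ n≤m)

leThr-fin⇔ : ∀ {x b t} → b ≤ x → Tᵇ (leThr (+ x - + b) (fin (+ t))) ⇔ x ∸ b ≤ t
leThr-fin⇔ {x} {b} {t} b≤x rewrite +m-+n≡+[m∸n] b≤x = T-≤ᵇ⇔ (x ∸ b) t

leThr-zero : ∀ {m u} n → InB m u → Tᵇ (leThr (+ n - + n) u)
leThr-zero n (inB-fin j _) = from (leThr-fin⇔ {n} {n} ≤-refl) (subst (_≤ j) (sym (n∸n≡0 n)) z≤n)
leThr-zero n inB-∞         = tt

leThr-∸ᵗ : ∀ d u r → leThr (d - + r) (u -ᵗ r) ≡ leThr d u
leThr-∸ᵗ d ∞       r = refl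
leThr-∸ᵗ d (fin z) r = T-injective (mk⇔
  (λ t → ℤ.≤⇒≤ᵇ (subst₂ ℤ._≤_ (−+-cancel d (+ r)) (−+-cancel z (+ r))
                        (ℤ.+-monoˡ-≤ (+ r) (ℤ.≤ᵇ⇒≤ {d - + r} {z - + r} t))))
  (λ t → ℤ.≤⇒≤ᵇ (ℤ.+-monoˡ-≤ (ℤ.- + r) (ℤ.≤ᵇ⇒≤ {d} {z} t))))
  where
  −+-cancel : ∀ (a b : ℤ) → a - b ℤ.+ b ≡ a
  −+-cancel = solve-∀

leThr-shift : ∀ {n} j k x u → n ≡ j + k → leThr (+ n - + x) u ≡ leThr (+ j - + x) (u -ᵗ k)
leThr-shift j k x u refl = begin
  leThr (+ (j + k) - + x) u                     ≡⟨ leThr-∸ᵗ _ u k ⟨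
  leThr (+ (j + k) - + x - + k) (u -ᵗ k)        ≡⟨ cong (λ d → leThr (d - + x - + k) (u -ᵗ k)) (ℤ.pos-+ j k) ⟩
  leThr (+ j ℤ.+ + k - + x - + k) (u -ᵗ k)      ≡⟨ cong (λ d → leThr d (u -ᵗ k)) (cancel (+ j) (+ k) (+ x)) ⟩
  leThr (+ j - + x) (u -ᵗ k)                    ∎
  where
  open ≡-Reasoning
  cancel : ∀ (a b c : ℤ) → a ℤ.+ b - c - b ≡ a - c
  cancel = solve-∀

leThr-first : ∀ {n} k j s u → n ≡ k + j → leThr (+ n - + (j + s)) u ≡ leThr (+ k - + s) u
leThr-first k j s u refl = cong (λ d → leThr d u) (begin
  + (k + j) - + (j + s)             ≡⟨ cong₂ _-_ (ℤ.pos-+ k j) (ℤ.pos-+ j s) ⟩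
  (+ k ℤ.+ + j) - (+ j ℤ.+ + s)     ≡⟨ cancel (+ k) (+ j) (+ s) ⟩
  + k - + s                         ∎)
  where
  open ≡-Reasoning
  cancel : ∀ (a b c : ℤ) → (a ℤ.+ b) - (b ℤ.+ c) ≡ a - c
  cancel = solve-∀

∣-∣≤⇔leThr : ∀ {m} k {j b} → b ≤ j →
             ∣ (k + j) - b ∣ ≤ m ⇔ (k ≤ m × Tᵇ (leThr (+ j - + b) (fin (+ (m ∸ k)))))
∣-∣≤⇔leThr {m} k {j} {b} b≤j rewrite m≤n⇒∣n-m∣≡n∸m (≤-trans b≤j (m≤n+m j k)) | +-∸-assoc k b≤j = mk⇔
  (λ k+d≤m → m+n≤o⇒m≤o k k+d≤m ,
             from (leThr-fin⇔ b≤j) (m+n≤o⇒m≤o∸n (j ∸ b) (subst (_≤ m) (+-comm k _) k+d≤m)))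
  (λ (k≤m , t) → subst (_≤ m) (+-comm (j ∸ b) k) (m≤o∸n⇒m+n≤o (j ∸ b) k≤m (to (leThr-fin⇔ b≤j) t)))

Tlist : ℕ → Thr → Thr → ℕ → List (List ℕ)
Tlist m u v n = filterᵇ (λ π → leThr (+ n - + firstE π) u ∧ leThr (+ n - + lastE π) v) (A m n)

record InT (m : ℕ) (u v : Thr) (n : ℕ) (π : List ℕ) : Set where
  constructor inT
  field
    perm     : IsPerm n π
    avoids   : Avoids132 π
    adjacent : Tᵇ (adjOK m π)
    first≤   : Tᵇ (leThr (+ n - + firstE π) u)
    last≤    : Tᵇ (leThr (+ n - + lastE π) v)

∈-Tlist⇔ : ∀ m u v n {π} → π ∈ Tlist m u v n ⇔ InT m u v n π
∈-Tlist⇔ m u v n = mk⇔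
  (λ π∈ → let π∈A , ends = to (∈-filterᵇ⇔ _) π∈
              (perm , av) , adj = to (∈-A⇔ m n) π∈A
              first , last = to T-∧ ends
          in inT perm av adj first last)
  (λ (inT perm av adj first last) →
     from (∈-filterᵇ⇔ _) (from (∈-A⇔ m n) ((perm , av) , adj) , from T-∧ (first , last)))

Unique-Tlist : ∀ m u v n → Unique (Tlist m u v n)
Unique-Tlist m u v n = Unique.filter⁺ _ (Unique-A m n)

-- c₁,ₚ = 1 counts the empty prefix: π then starts with its maximum n, and n - n = 0 ≤ p.
prefixes : Thr → ℕ → List (List ℕ)
prefixes p (suc zero) = [ [] ]
prefixes p k          = filterᵇ (λ σ → leThr (+ k - + firstE σ) p) (av132 (k ∸ 1))

c≡length-prefixes : ∀ k p → c k p ≡ length (prefixes p k)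
c≡length-prefixes zero          p = refl
c≡length-prefixes (suc zero)    p = refl
c≡length-prefixes (suc (suc k)) p = refl

FirstWithin : Thr → ℕ → List ℕ → Set
FirstWithin p k []      = ⊤
FirstWithin p k (s ∷ _) = Tᵇ (leThr (+ k - + s) p)

∈-prefixes⇔ : ∀ p l {σ} → σ ∈ prefixes p (suc l) ⇔ (IsPerm l σ × Avoids132 σ × FirstWithin p (suc l) σ)
∈-prefixes⇔ p zero    {σ} = mk⇔ (λ { (here refl) → isPermOf refl [] [] , tt , tt })
                                 (λ { (isPermOf len _ _ , _) → here (length≡0⇒[] σ len) })
∈-prefixes⇔ p (suc l) {[]}    = mk⇔
  (λ σ∈ → let σ∈av , _ = to (∈-filterᵇ⇔ _) σ∈ in
          contradiction (IsPermOf.length≡ (proj₁ (to (∈-av132⇔ (suc l)) σ∈av))) λ ())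
  (λ { (isPermOf () _ _ , _) })
∈-prefixes⇔ p (suc l) {s ∷ σ} = mk⇔
  (λ σ∈ → let σ∈av , first = to (∈-filterᵇ⇔ _) σ∈ ; perm , av = to (∈-av132⇔ (suc l)) σ∈av in perm , av , first)
  (λ (perm , av , first) → from (∈-filterᵇ⇔ _) (from (∈-av132⇔ (suc l)) (perm , av) , first))

Unique-prefixes : ∀ p l → Unique (prefixes p (suc l))
Unique-prefixes p zero    = [] ∷ []
Unique-prefixes p (suc l) = Unique.filter⁺ _ (Unique-av132 (suc l))

-- Splitting at the maximum

recurrenceSum : ℕ → Thr → Thr → ℕ → ℕ → ℕ
recurrenceSum m p q n K =
  sumFrom1 K (λ k → c k p * T m (fin (+ (m ∸ k))) (q -ᵗ k) (n ∸ k)) + T m (p -ᵗ 1) (fin (+ (m ∸ 1))) (n ∸ 1)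

module Decomposition (m n′ : ℕ) (p q : Thr) (1≤m : 1 ≤ m) (1≤n′ : 1 ≤ n′) (p∈B : InB m p) (q∈B : InB m q) where

  n : ℕ
  n = suc n′

  first-glue⇔ : ∀ k {j} σ β → n ≡ k + j →
                Tᵇ (leThr (+ n - + firstE (shift j σ ++ n ∷ β)) p) ⇔ FirstWithin p k σ
  first-glue⇔ k     []      β n≡ = mk⇔ (λ _ → tt) (λ _ → leThr-zero n p∈B)
  first-glue⇔ k {j} (s ∷ σ) β n≡ = mk⇔ (subst Tᵇ e) (subst Tᵇ (sym e))
    where e = leThr-first k j s p n≡

  last-glue⇔ : ∀ j k α b β → n ≡ j + k →
               Tᵇ (leThr (+ n - + lastE (α ++ n ∷ b ∷ β)) q) ⇔ Tᵇ (leThr (+ j - + lastE (b ∷ β)) (q -ᵗ k))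
  last-glue⇔ j k α b β n≡ = mk⇔ (subst Tᵇ e) (subst Tᵇ (sym e))
    where
    e = trans (cong (λ x → leThr (+ n - + x) q) (lastE-++-∷ α n (b ∷ β))) (leThr-shift j k (lastE (b ∷ β)) q n≡)

  glue-InT : ∀ {l j σ b β} → n ≡ suc l + j → suc l ≤ m →
             IsPerm l σ → Avoids132 σ → FirstWithin p (suc l) σ →
             InT m (fin (+ (m ∸ suc l))) (q -ᵗ suc l) j (b ∷ β) → InT m p q n (shift j σ ++ n ∷ b ∷ β)
  glue-InT {l} {j} {σ} {b} {β} n≡ k≤m σ-perm σ-av σ-first (inT β-perm β-av β-adj β-first β-last) =
    inT (proj₁ joined) (proj₂ joined) adjacent
        (from (first-glue⇔ (suc l) σ (b ∷ β) n≡) σ-first)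
        (from (last-glue⇔ j (suc l) (shift j σ) b β n≡′) β-last)
    where
    n≡′ : n ≡ j + suc l
    n≡′ = trans n≡ (+-comm (suc l) j)
    α-perm = IsPerm-shift j σ-perm
    joined = IsPerm-join-at-max n (trans n≡′ (+-suc j l)) α-perm β-perm (from (Avoids132-shift j σ) σ-av) β-av
    α∷ʳn-near : All (λ x → j ≤ x × x ≤ j + m) (shift j σ ∷ʳ n)
    α∷ʳn-near =
      All.++⁺ (All.map (λ (j<x , x≤j+l) → <⇒≤ j<x , ≤-trans x≤j+l (+-monoʳ-≤ j (≤-trans (n≤1+n l) k≤m)))
                       (IsPermOf.bounds α-perm))
              ((subst (j ≤_) (sym n≡′) (m≤m+n j (suc l)) , subst (_≤ j + m) (sym n≡′) (+-monoʳ-≤ j k≤m)) ∷ [])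
    n-b-near : ∣ n - b ∣ ≤ m
    n-b-near = subst (λ t → ∣ t - b ∣ ≤ m) (sym n≡)
                 (from (∣-∣≤⇔leThr (suc l) (proj₂ (All.head (IsPermOf.bounds β-perm)))) (k≤m , β-first))
    adjacent = subst Tᵇ (sym (adjOK-++-∷ m (shift j σ) n (b ∷ β)))
                 (from T-∧ (adjOK-interval m j α∷ʳn-near , from (adjOK-∷-∷⇔ m n b β) (n-b-near , β-adj)))

  InT-unglue : ∀ α b β → InT m p q n (α ++ n ∷ b ∷ β) →
               let l = length α ; j = length (b ∷ β) in
               suc l ≤ m ×
               ∃[ σ ] α ≡ shift j σ × IsPerm l σ × Avoids132 σ × FirstWithin p (suc l) σ ×
                      InT m (fin (+ (m ∸ suc l))) (q -ᵗ suc l) j (b ∷ β)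
  InT-unglue α b β (inT perm av adj first last) =
    k≤m , σ , α≡ , σ-perm , σ-av , σ-first , inT β-perm β-av β-adj β-first (to (last-glue⇔ j (suc l) α b β n≡′) last)
    where
    l = length α
    j = length (b ∷ β)
    n≡ = length-split α (b ∷ β) perm
    n≡′ : n ≡ j + suc l
    n≡′ = trans n≡ (+-comm (suc l) j)
    split = IsPerm-split-at-max α (b ∷ β) perm av
    β-perm = proj₁ (proj₂ split)
    β-av = proj₂ (proj₂ (proj₂ split))
    unshifted = IsPermOf-unshift (proj₁ split)
    σ = proj₁ unshifted
    α≡ = proj₁ (proj₂ unshifted)
    σ-perm = proj₂ (proj₂ unshifted)
    σ-av = to (Avoids132-shift j σ) (subst Avoids132 α≡ (proj₁ (proj₂ (proj₂ split))))
    σ-first = to (first-glue⇔ (suc l) σ (b ∷ β) n≡)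
                 (subst (λ α → Tᵇ (leThr (+ n - + firstE (α ++ n ∷ b ∷ β)) p)) α≡ first)
    n∷β-adj = to (adjOK-∷-∷⇔ m n b β)
                 (proj₂ (to (T-∧ {adjOK m (α ∷ʳ n)}) (subst Tᵇ (adjOK-++-∷ m α n (b ∷ β)) adj)))
    β-adj = proj₂ n∷β-adj
    near = to (∣-∣≤⇔leThr (suc l) (proj₂ (All.head (IsPermOf.bounds β-perm))))
              (subst (λ t → ∣ t - b ∣ ≤ m) n≡ (proj₁ n∷β-adj))
    k≤m = proj₁ near
    β-first = proj₂ near

  n-near⇔ : ∀ {a} → a ≤ n′ → ∣ a - n ∣ ≤ m ⇔ Tᵇ (leThr (+ n′ - + a) (fin (+ (m ∸ 1))))
  n-near⇔ {a} a≤n′ = mk⇔ (λ near → proj₂ (to (∣-∣≤⇔leThr 1 a≤n′) (subst (_≤ m) (∣-∣-comm a n) near)))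
                         (λ t → subst (_≤ m) (∣-∣-comm n a) (from (∣-∣≤⇔leThr 1 a≤n′) (1≤m , t)))

  first-end⇔ : ∀ a → Tᵇ (leThr (+ n - + a) p) ⇔ Tᵇ (leThr (+ n′ - + a) (p -ᵗ 1))
  first-end⇔ a = mk⇔ (subst Tᵇ e) (subst Tᵇ (sym e))
    where e = leThr-shift n′ 1 a p (+-comm 1 n′)

  end-InT : ∀ {α} → InT m (p -ᵗ 1) (fin (+ (m ∸ 1))) n′ α → InT m p q n (α ∷ʳ n)
  end-InT {[]}    (inT perm _ _ _ _) = contradiction (IsPermOf.length≡ perm) (<⇒≢ 1≤n′)
  end-InT {a ∷ α} (inT perm av adj first last) =
    inT (proj₁ joined) (proj₂ joined) adjacent (from (first-end⇔ a) first)
        (subst (λ x → Tᵇ (leThr (+ n - + x) q)) (sym (lastE-++-∷ (a ∷ α) n [])) (leThr-zero n q∈B))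
    where
    joined = IsPerm-join-at-max n refl perm (isPermOf refl [] []) av tt
    last≤n′ = proj₂ (All.lookup (IsPermOf.bounds perm) (lastE-∈ a α))
    adjacent = subst Tᵇ (sym (adjOK-∷ʳ m a α n))
                 (from T-∧ (adj , from (T-≤ᵇ⇔ _ m) (from (n-near⇔ last≤n′) last)))

  InT-unend : ∀ α → InT m p q n (α ∷ʳ n) → InT m (p -ᵗ 1) (fin (+ (m ∸ 1))) n′ α
  InT-unend α (inT perm av adj first last) with IsPerm-split-at-max α [] perm av
  InT-unend []      (inT perm _ _ _ _)     | _ =
    contradiction (suc-injective (length-split [] [] perm)) (<⇒≢ 1≤n′ ∘ sym)
  InT-unend (a ∷ α) (inT perm _ adj first _) | α-perm , _ , α-av , _ =
    inT (subst (λ l → IsPermOf 0 l (a ∷ α)) (sym n′≡) α-perm) α-av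
        (proj₁ adjacent) (to (first-end⇔ a) first) (to (n-near⇔ last≤n′) (to (T-≤ᵇ⇔ _ m) (proj₂ adjacent)))
    where
    n′≡ : n′ ≡ length (a ∷ α)
    n′≡ = trans (suc-injective (length-split (a ∷ α) [] perm)) (+-identityʳ _)
    adjacent = to T-∧ (subst Tᵇ (adjOK-∷ʳ m a α n) adj)
    last≤n′ = subst (lastE (a ∷ α) ≤_) (sym n′≡) (proj₂ (All.lookup (IsPermOf.bounds α-perm) (lastE-∈ a α)))

  K : ℕ
  K = m ⊓ n′

  suffixes : ℕ → List (List ℕ)
  suffixes k = Tlist m (fin (+ (m ∸ k))) (q -ᵗ k) (n ∸ k)

  glue : ℕ → List ℕ → List ℕ → List ℕ
  glue k σ β = shift (n ∸ k) σ ++ n ∷ β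

  block : ℕ → List (List ℕ)
  block k = cartesianProductWith (glue k) (prefixes p k) (suffixes k)

  truncations : List (List ℕ)
  truncations = Tlist m (p -ᵗ 1) (fin (+ (m ∸ 1))) n′

  decompositions : List (List ℕ)
  decompositions = concatFrom1 K block ++ map (_∷ʳ n) truncations

  length-decompositions : length decompositions ≡ recurrenceSum m p q n K
  length-decompositions = begin
    length (concatFrom1 K block ++ map (_∷ʳ n) truncations)
      ≡⟨ length-++ (concatFrom1 K block) ⟩
    length (concatFrom1 K block) + length (map (_∷ʳ n) truncations)
      ≡⟨ cong₂ _+_ (length-concatFrom1 K block) (length-map (_∷ʳ n) truncations) ⟩
    sumFrom1 K (length ∘ block) + length truncations
      ≡⟨ cong (_+ length truncations) (sumFrom1-cong K length-block) ⟩
    recurrenceSum m p q n K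
      ∎
    where
    open ≡-Reasoning
    length-block : ∀ k → length (block k) ≡ c k p * T m (fin (+ (m ∸ k))) (q -ᵗ k) (n ∸ k)
    length-block k = trans (length-cartesianProductWith (glue k) (prefixes p k) (suffixes k))
                           (cong (_* length (suffixes k)) (sym (c≡length-prefixes k p)))

  ∈-block⁻ : ∀ k {x} → x ∈ block k → ∃₂ λ σ β → σ ∈ prefixes p k × β ∈ suffixes k × x ≡ glue k σ β
  ∈-block⁻ k = ∈-cartesianProductWith⁻ (glue k) (prefixes p k) (suffixes k)

  ∈-suffixes⇔ : ∀ k {β} → β ∈ suffixes k ⇔ InT m (fin (+ (m ∸ k))) (q -ᵗ k) (n ∸ k) β
  ∈-suffixes⇔ k = ∈-Tlist⇔ m (fin (+ (m ∸ k))) (q -ᵗ k) (n ∸ k)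

  ∈-truncations⇔ : ∀ {α} → α ∈ truncations ⇔ InT m (p -ᵗ 1) (fin (+ (m ∸ 1))) n′ α
  ∈-truncations⇔ = ∈-Tlist⇔ m (p -ᵗ 1) (fin (+ (m ∸ 1))) n′

  Unique-suffixes : ∀ k → Unique (suffixes k)
  Unique-suffixes k = Unique-Tlist m (fin (+ (m ∸ k))) (q -ᵗ k) (n ∸ k)

  Unique-truncations : Unique truncations
  Unique-truncations = Unique-Tlist m (p -ᵗ 1) (fin (+ (m ∸ 1))) n′

  K≤n′ : K ≤ n′
  K≤n′ = m⊓n≤n m n′

  n≡k+[n∸k] : ∀ {k} → k ≤ n → n ≡ k + (n ∸ k)
  n≡k+[n∸k] k≤n = sym (m+[n∸m]≡n k≤n)

  n∉shifted-prefix : ∀ {l σ} → suc l ≤ n → σ ∈ prefixes p (suc l) → n ∉ shift (n ∸ suc l) σ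
  n∉shifted-prefix {l} k≤n σ∈ n∈ =
    <-irrefl refl (≤-<-trans (proj₂ (All.lookup (IsPermOf.bounds (IsPerm-shift j σ-perm)) n∈)) j+l<n)
    where
    j = n ∸ suc l
    σ-perm = proj₁ (to (∈-prefixes⇔ p l) σ∈)
    j+l<n : j + l < n
    j+l<n = subst (j + l <_) (sym (trans (n≡k+[n∸k] k≤n) (cong suc (+-comm l j)))) ≤-refl

  block-split : ∀ {l x} → suc l ≤ n′ → x ∈ block (suc l) →
                ∃₂ λ α β → x ≡ α ++ n ∷ β × n ∉ α × length α ≡ l × β ≢ []
  block-split {l} k≤n′ x∈ with σ , β , σ∈ , β∈ , refl ← ∈-block⁻ (suc l) x∈ =
    shift (n ∸ suc l) σ , β , refl , n∉shifted-prefix (m≤n⇒m≤1+n k≤n′) σ∈ ,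
    trans (length-map _ σ) (IsPermOf.length≡ (proj₁ (to (∈-prefixes⇔ p l) σ∈))) ,
    λ { refl → <⇒≢ (m<n⇒0<n∸m k≤n′) (IsPermOf.length≡ (InT.perm (to (∈-suffixes⇔ (suc l)) β∈))) }

  Unique-block : ∀ {l} → suc l ≤ n → Unique (block (suc l))
  Unique-block {l} k≤n =
    Unique-cartesianProductWith⁺-on (glue (suc l)) glue-injective (Unique-prefixes p l) (Unique-suffixes (suc l))
    where
    glue-injective : ∀ {σ σ′ β β′} → σ ∈ prefixes p (suc l) → σ′ ∈ prefixes p (suc l) → β ∈ suffixes (suc l) →
                     β′ ∈ suffixes (suc l) → glue (suc l) σ β ≡ glue (suc l) σ′ β′ → σ ≡ σ′ × β ≡ β′
    glue-injective σ∈ σ′∈ _ _ eq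
      with σ≡ , β≡ ← ++-∷-injective _ _ (n∉shifted-prefix k≤n σ∈) (n∉shifted-prefix k≤n σ′∈) eq =
      map-injective (+-cancelˡ-≡ (n ∸ suc l) _ _) σ≡ , β≡

  Unique-decompositions : Unique decompositions
  Unique-decompositions = Unique.++⁺
    (Unique-concatFrom1 K block (λ k≤K → Unique-block (≤-trans k≤K (≤-trans K≤n′ (n≤1+n n′)))) blocks-disjoint)
    (Unique.map⁺ (λ {xs} {ys} → ∷ʳ-injectiveˡ xs ys) Unique-truncations)
    blocks-ends-disjoint
    where
    blocks-disjoint : ∀ {k k′ x} → suc k ≤ K → suc k′ ≤ K → x ∈ block (suc k) → x ∈ block (suc k′) → k ≡ k′
    blocks-disjoint k≤K k′≤K x∈ x∈′
      with α , β , refl , n∉α , refl , _ ← block-split (≤-trans k≤K K≤n′) x∈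
      with α′ , β′ , eq , n∉α′ , refl , _ ← block-split (≤-trans k′≤K K≤n′) x∈′ =
      cong length (proj₁ (++-∷-injective α α′ n∉α n∉α′ eq))
    n∉truncation : ∀ {α} → α ∈ truncations → n ∉ α
    n∉truncation α∈ n∈ = 1+n≰n (proj₂ (All.lookup (IsPermOf.bounds (InT.perm (to ∈-truncations⇔ α∈))) n∈))
    blocks-ends-disjoint : Disjoint (concatFrom1 K block) (map (_∷ʳ n) truncations)
    blocks-ends-disjoint (x∈blocks , x∈ends)
      with k , k≤K , x∈ ← ∈-concatFrom1⁻ K block x∈blocks
      with α , β , refl , n∉α , _ , β≢[] ← block-split (≤-trans k≤K K≤n′) x∈
      with α′ , α′∈ , eq ← ∈-map⁻ (_∷ʳ n) x∈ends =
      β≢[] (proj₂ (++-∷-injective α α′ n∉α (n∉truncation α′∈) eq))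

  decompositions⊆Tlist : ∀ {π} → π ∈ decompositions → π ∈ Tlist m p q n
  decompositions⊆Tlist π∈ with ∈-++⁻ (concatFrom1 K block) π∈
  ... | inj₂ π∈ends with α , α∈ , refl ← ∈-map⁻ (_∷ʳ n) π∈ends =
    from (∈-Tlist⇔ m p q n) (end-InT (to ∈-truncations⇔ α∈))
  ... | inj₁ π∈blocks
    with l , k≤K , π∈block ← ∈-concatFrom1⁻ K block π∈blocks
    with σ , β , σ∈ , β∈ , refl ← ∈-block⁻ (suc l) π∈block
    with σ-perm , σ-av , σ-first ← to (∈-prefixes⇔ p l) σ∈
    with β
  ... | []    = contradiction (IsPermOf.length≡ (InT.perm (to (∈-suffixes⇔ (suc l)) β∈)))
                              (<⇒≢ (m<n⇒0<n∸m (≤-trans k≤K K≤n′)))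
  ... | _ ∷ _ = from (∈-Tlist⇔ m p q n)
                     (glue-InT (n≡k+[n∸k] (≤-trans k≤K (≤-trans K≤n′ (n≤1+n n′)))) (≤-trans k≤K (m⊓n≤m m n′))
                               σ-perm σ-av σ-first (to (∈-suffixes⇔ (suc l)) β∈))

  split⊆decompositions : ∀ α β → InT m p q n (α ++ n ∷ β) → α ++ n ∷ β ∈ decompositions
  split⊆decompositions α []      πT =
    ∈-++⁺ʳ (concatFrom1 K block) (∈-map⁺ (_∷ʳ n) (from ∈-truncations⇔ (InT-unend α πT)))
  split⊆decompositions α (b ∷ β) πT =
    let k≤m , σ , α≡ , σ-perm , σ-av , σ-first , βT = InT-unglue α b β πT in
    ∈-++⁺ˡ (∈-concatFrom1⁺ K block (⊓-glb k≤m k≤n′)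
             (subst (_∈ block (suc l)) (glue≡ α≡)
                    (∈-cartesianProductWith⁺ (glue (suc l)) (from (∈-prefixes⇔ p l) (σ-perm , σ-av , σ-first))
                                                            (β∈ βT))))
    where
    l = length α
    j = length (b ∷ β)
    n≡ : n ≡ suc l + j
    n≡ = length-split α (b ∷ β) (InT.perm πT)
    j≡ : n ∸ suc l ≡ j
    j≡ = trans (cong (_∸ suc l) n≡) (m+n∸m≡n (suc l) j)
    k≤n′ : suc l ≤ n′
    k≤n′ = subst (suc l ≤_) (sym (trans (suc-injective n≡) (+-suc l (length β)))) (s≤s (m≤m+n l (length β)))
    β∈ : InT m (fin (+ (m ∸ suc l))) (q -ᵗ suc l) j (b ∷ β) → b ∷ β ∈ suffixes (suc l)
    β∈ βT = from (∈-suffixes⇔ (suc l))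
                 (subst (λ j → InT m (fin (+ (m ∸ suc l))) (q -ᵗ suc l) j (b ∷ β)) (sym j≡) βT)
    glue≡ : ∀ {σ} → α ≡ shift j σ → glue (suc l) σ (b ∷ β) ≡ α ++ n ∷ b ∷ β
    glue≡ {σ} α≡ = cong (_++ n ∷ b ∷ β) (trans (cong (λ j → shift j σ) j≡) (sym α≡))

  Tlist⊆decompositions : ∀ {π} → π ∈ Tlist m p q n → π ∈ decompositions
  Tlist⊆decompositions π∈ with πT ← to (∈-Tlist⇔ m p q n) π∈
    with α , β , refl ← ∈-∃++ (IsPerm-∋-max (InT.perm πT)) = split⊆decompositions α β πT

  recurrence : T m p q n ≡ recurrenceSum m p q n K
  recurrence = trans (Unique-length-≡ (Unique-Tlist m p q n) Unique-decompositions
                                      (mk⇔ Tlist⊆decompositions decompositions⊆Tlist))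
                     length-decompositions

theorem2p4 : (m : ℕ) → 1 ≤ m →
    ((n : ℕ) → 2 ≤ n → (p q : Thr) → InB m p → InB m q →
      T m p q n ≡
        sumFrom1 (m ⊓ (n ∸ 1)) (λ k → c k p * T m (fin (+ (m ∸ k))) (q -ᵗ k) (n ∸ k))
        + T m (p -ᵗ 1) (fin (+ (m ∸ 1))) (n ∸ 1))
    × ((n : ℕ) → m + 1 ≤ n → (p q : Thr) → InB m p → InB m q →
      T m p q n ≡
        sumFrom1 m (λ k → c k p * T m (fin (+ (m ∸ k))) (q -ᵗ k) (n ∸ k))
        + T m (p -ᵗ 1) (fin (+ (m ∸ 1))) (n ∸ 1))
theorem2p4 m 1≤m = recurrence , λ n m+1≤n p q p∈B q∈B →
  subst (λ K → T m p q n ≡ recurrenceSum m p q n K) (m≤n⇒m⊓n≡m (m+n≤o⇒m≤o∸n m m+1≤n))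
        (recurrence n (≤-trans (+-monoˡ-≤ 1 1≤m) m+1≤n) p q p∈B q∈B)
  where
  recurrence : ∀ n → 2 ≤ n → ∀ p q → InB m p → InB m q → T m p q n ≡ recurrenceSum m p q n (m ⊓ (n ∸ 1))
  recurrence (suc n′) (s≤s 1≤n′) p q = Decomposition.recurrence m n′ p q 1≤m 1≤n′
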